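{- $\mathrm{INF}_\mathsf{Set}$ is equiconsistent with $\mathrm{INFU}_\mathsf{Set}+(|V|=|\mathcal{P}(V)|)$, and $\mathrm{NF}_\mathsf{Set}$ is equiconsistent with $\mathrm{NFU}_\mathsf{Set}+(|V|=|\mathcal{P}(V)|)$.
   Context: $\mathcal{L}_\mathsf{Set}=\{\in,S,\langle-,-\rangle\}$ ($\in$ binary relation, $S$ unary "sethood" predicate, $\langle-,-\rangle$ binary function symbol). A formula is stratified if there is $s:\mathrm{terms}\to\mathbb{N}$ with $s(\langle v,w\rangle)=s(v)=s(w)$, $s(u)=s(v)$ for atomic $u=v$, and $s(u)+1=s(v)$ for atomic $u\in v$. $\mathrm{INFU}_\mathsf{Set}$ (intuitionistic logic) and $\mathrm{NFU}_\mathsf{Set}$ (classical logic) have axioms: $\mathrm{Ext}_S$: $(S(x)\wedge S(y)\wedge\forall z(z\in x\leftrightarrow z\in y))\to x=y$; $\mathrm{SC}_S$: for each stratified $\phi$ (with parameters, $x$ not free) $\exists x(S(x)\wedge\forall z(z\in x\leftrightarrow\phi(z)))$; Ordered Pair: $\langle x,y\rangle=\langle x',y'\rangle\to(x=x'\wedge y=y')$; Sethood: $z\in x\to S(x)$. $\mathrm{INF}_\mathsf{Set}$, $\mathrm{NF}_\mathsf{Set}$ add $\forall x.S(x)$. $V$ is the universal set $\{x\mid x=x\}$; $\mathcal{P}(V)=\{z\mid S(z)\wedge\forall u(u\in z\to u\in V)\}$, the set of all sets; $|V|=|\mathcal{P}(V)|$ means there is a bijection between $V$ and $\mathcal{P}(V)$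 coded as a set of ordered pairs $\langle-,-\rangle$. -}

module Defs where

-- Variables are de Bruijn indices: var 0 is the innermost bound variable.

open import Data.Nat using (ℕ; zero; suc)
open import Data.Product using (Σ; _×_)
open import Data.Sum using (_⊎_)
open import Data.Unit using (⊤)
open import Data.List using (List; []; _∷_; map)
open import Data.List.Membership.Propositional using (_∈_)
open import Relation.Binary.PropositionalEquality using (_≡_)
open import Relation.Nullary using (¬_)

infix  7 _∈ₛ_ _≐_
infixr 6 _∧ᶠ_
infixr 5 _∨ᶠ_
infixr 4 _⇒_ _⇔ᶠ_

data Term : Set where
  var  : ℕ → Term
  ⟨_,_⟩ : Term → Term → Term

data Formula : Set where
  _∈ₛ_ _≐_ : Term → Term → Formula
  S : Term → Formula
  ⊥ᶠ : Formula
  _∧ᶠ_ _∨ᶠ_ _⇒_ : Formula → Formula → Formula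
  ∀ᶠ ∃ᶠ : Formula → Formula

¬ᶠ_ : Formula → Formula
¬ᶠ φ = φ ⇒ ⊥ᶠ

_⇔ᶠ_ : Formula → Formula → Formula
φ ⇔ᶠ ψ = (φ ⇒ ψ) ∧ᶠ (ψ ⇒ φ)

_∷ₑ_ : {A : Set} → A → (ℕ → A) → ℕ → A
(a ∷ₑ σ) zero    = a
(a ∷ₑ σ) (suc i) = σ i

extR : (ℕ → ℕ) → ℕ → ℕ
extR ρ zero    = zero
extR ρ (suc i) = suc (ρ i)

renT : (ℕ → ℕ) → Term → Term
renT ρ (var i)   = var (ρ i)
renT ρ ⟨ t , u ⟩ = ⟨ renT ρ t , renT ρ u ⟩

renF : (ℕ → ℕ) → Formula → Formula
renF ρ (t ∈ₛ u) = renT ρ t ∈ₛ renT ρ u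
renF ρ (t ≐ u)  = renT ρ t ≐ renT ρ u
renF ρ (S t)    = S (renT ρ t)
renF ρ ⊥ᶠ       = ⊥ᶠ
renF ρ (φ ∧ᶠ ψ) = renF ρ φ ∧ᶠ renF ρ ψ
renF ρ (φ ∨ᶠ ψ) = renF ρ φ ∨ᶠ renF ρ ψ
renF ρ (φ ⇒ ψ)  = renF ρ φ ⇒ renF ρ ψ
renF ρ (∀ᶠ φ)   = ∀ᶠ (renF (extR ρ) φ)
renF ρ (∃ᶠ φ)   = ∃ᶠ (renF (extR ρ) φ)

weaken : Formula → Formula
weaken = renF suc

extS : (ℕ → Term) → ℕ → Term
extS σ zero    = var zero
extS σ (suc i) = renT suc (σ i)

subT : (ℕ → Term) → Term → Term
subT σ (var i)   = σ i
subT σ ⟨ t , u ⟩ = ⟨ subT σ t , subT σ u ⟩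

subF : (ℕ → Term) → Formula → Formula
subF σ (t ∈ₛ u) = subT σ t ∈ₛ subT σ u
subF σ (t ≐ u)  = subT σ t ≐ subT σ u
subF σ (S t)    = S (subT σ t)
subF σ ⊥ᶠ       = ⊥ᶠ
subF σ (φ ∧ᶠ ψ) = subF σ φ ∧ᶠ subF σ ψ
subF σ (φ ∨ᶠ ψ) = subF σ φ ∨ᶠ subF σ ψ
subF σ (φ ⇒ ψ)  = subF σ φ ⇒ subF σ ψ
subF σ (∀ᶠ φ)   = ∀ᶠ (subF (extS σ) φ)
subF σ (∃ᶠ φ)   = ∃ᶠ (subF (extS σ) φ)

_[_]₀ : Formula → Term → Formula
φ [ t ]₀ = subF (t ∷ₑ var) φ

-- Stratification: an assignment of natural-number types to variables
-- (free variables via σ, each bound variable its own type), extended to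
-- terms with s(⟨v,w⟩) = s(v) = s(w); u = v needs s(u) = s(v) and
-- u ∈ v needs s(u) + 1 = s(v).

data TermTy (σ : ℕ → ℕ) : Term → ℕ → Set where
  tvar  : ∀ i → TermTy σ (var i) (σ i)
  tpair : ∀ {t u n} → TermTy σ t n → TermTy σ u n → TermTy σ ⟨ t , u ⟩ n

StratF : (ℕ → ℕ) → Formula → Set
StratF σ (t ∈ₛ u) = Σ ℕ λ n → TermTy σ t n × TermTy σ u (suc n)
StratF σ (t ≐ u)  = Σ ℕ λ n → TermTy σ t n × TermTy σ u n
StratF σ (S t)    = Σ ℕ λ n → TermTy σ t n
StratF σ ⊥ᶠ       = ⊤
StratF σ (φ ∧ᶠ ψ) = StratF σ φ × StratF σ ψ
StratF σ (φ ∨ᶠ ψ) = StratF σ φ × StratF σ ψ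
StratF σ (φ ⇒ ψ)  = StratF σ φ × StratF σ ψ
StratF σ (∀ᶠ φ)   = Σ ℕ λ k → StratF (k ∷ₑ σ) φ
StratF σ (∃ᶠ φ)   = Σ ℕ λ k → StratF (k ∷ₑ σ) φ

Stratified : Formula → Set
Stratified φ = Σ (ℕ → ℕ) λ σ → StratF σ φ

-- Ext_S : ∀x ∀y ((S x ∧ S y ∧ ∀z (z ∈ x ↔ z ∈ y)) → x = y)
extAx : Formula
extAx = ∀ᶠ (∀ᶠ ((S (var 1) ∧ᶠ S (var 0) ∧ᶠ
          ∀ᶠ (var 0 ∈ₛ var 2 ⇔ᶠ var 0 ∈ₛ var 1)) ⇒ var 1 ≐ var 0))

-- parameter shift: var 0 (= z) stays, parameters i+1 move past x
scShift : ℕ → ℕ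
scShift zero    = zero
scShift (suc i) = suc (suc i)

-- SC_S instance for φ(z) (z = var 0 of φ, other free vars parameters):
-- ∃x (S x ∧ ∀z (z ∈ x ↔ φ(z))), x not free in φ
scAx : Formula → Formula
scAx φ = ∃ᶠ (S (var 0) ∧ᶠ ∀ᶠ (var 0 ∈ₛ var 1 ⇔ᶠ renF scShift φ))

-- Ordered pair: ∀x∀y∀x'∀y' (⟨x,y⟩ = ⟨x',y'⟩ → x = x' ∧ y = y')
pairAx : Formula
pairAx = ∀ᶠ (∀ᶠ (∀ᶠ (∀ᶠ (⟨ var 3 , var 2 ⟩ ≐ ⟨ var 1 , var 0 ⟩ ⇒
           var 3 ≐ var 1 ∧ᶠ var 2 ≐ var 0))))

-- Sethood: ∀x∀z (z ∈ x → S x)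
sethoodAx : Formula
sethoodAx = ∀ᶠ (∀ᶠ (var 0 ∈ₛ var 1 ⇒ S (var 1)))

allSetsAx : Formula
allSetsAx = ∀ᶠ (S (var 0))

-- |V| = |P(V)| :
-- ∃V ∃P ∃f ( S V ∧ ∀x (x ∈ V ↔ x = x)
--          ∧ S P ∧ ∀z (z ∈ P ↔ (S z ∧ ∀u (u ∈ z → u ∈ V)))
--          ∧ S f ∧ ∀q (q ∈ f → ∃x∃y (q = ⟨x,y⟩ ∧ x ∈ V ∧ y ∈ P))
--          ∧ ∀x (x ∈ V → ∃y (y ∈ P ∧ ⟨x,y⟩ ∈ f))
--          ∧ ∀x∀y∀y' (⟨x,y⟩ ∈ f ∧ ⟨x,y'⟩ ∈ f → y = y')
--          ∧ ∀x∀x'∀y (⟨x,y⟩ ∈ f ∧ ⟨x',y⟩ ∈ f → x = x')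
--          ∧ ∀y (y ∈ P → ∃x ⟨x,y⟩ ∈ f) )
cardAx : Formula
cardAx = ∃ᶠ (∃ᶠ (∃ᶠ (
    -- V = var 2, P = var 1, f = var 0
    (S (var 2) ∧ᶠ ∀ᶠ (var 0 ∈ₛ var 3 ⇔ᶠ var 0 ≐ var 0))
  ∧ᶠ (S (var 1) ∧ᶠ ∀ᶠ (var 0 ∈ₛ var 2 ⇔ᶠ
        (S (var 0) ∧ᶠ ∀ᶠ (var 0 ∈ₛ var 1 ⇒ var 0 ∈ₛ var 4))))
  ∧ᶠ S (var 0)
  ∧ᶠ ∀ᶠ (var 0 ∈ₛ var 1 ⇒ ∃ᶠ (∃ᶠ (var 2 ≐ ⟨ var 1 , var 0 ⟩ ∧ᶠ
        var 1 ∈ₛ var 5 ∧ᶠ var 0 ∈ₛ var 4)))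
  ∧ᶠ ∀ᶠ (var 0 ∈ₛ var 3 ⇒ ∃ᶠ (var 0 ∈ₛ var 3 ∧ᶠ ⟨ var 1 , var 0 ⟩ ∈ₛ var 2))
  ∧ᶠ ∀ᶠ (∀ᶠ (∀ᶠ ((⟨ var 2 , var 1 ⟩ ∈ₛ var 3 ∧ᶠ ⟨ var 2 , var 0 ⟩ ∈ₛ var 3)
        ⇒ var 1 ≐ var 0)))
  ∧ᶠ ∀ᶠ (∀ᶠ (∀ᶠ ((⟨ var 2 , var 0 ⟩ ∈ₛ var 3 ∧ᶠ ⟨ var 1 , var 0 ⟩ ∈ₛ var 3)
        ⇒ var 2 ≐ var 1)))
  ∧ᶠ ∀ᶠ (var 0 ∈ₛ var 2 ⇒ ∃ᶠ (⟨ var 0 , var 1 ⟩ ∈ₛ var 2)))))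

-- A theory is a predicate on formulas (its axioms; free variables are
-- implicitly universally quantified).
Theory : Set₁
Theory = Formula → Set

data NFUAxiom : Theory where
  ext     : NFUAxiom extAx
  sc      : ∀ φ → Stratified φ → NFUAxiom (scAx φ)
  pair    : NFUAxiom pairAx
  sethood : NFUAxiom sethoodAx

_⊕_ : Theory → Formula → Theory
(T ⊕ ψ) φ = T φ ⊎ φ ≡ ψ

NFAxiom : Theory
NFAxiom = NFUAxiom ⊕ allSetsAx

data Logic : Set where
  intuitionistic classical : Logic

data Deriv (L : Logic) (T : Theory) : List Formula → Formula → Set where
  hyp  : ∀ {Γ φ} → φ ∈ Γ → Deriv L T Γ φ
  ax   : ∀ {Γ φ} → T φ → Deriv L T Γ φ
  ⊥E   : ∀ {Γ φ} → Deriv L T Γ ⊥ᶠ → Deriv L T Γ φ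
  ∧I   : ∀ {Γ φ ψ} → Deriv L T Γ φ → Deriv L T Γ ψ → Deriv L T Γ (φ ∧ᶠ ψ)
  ∧E₁  : ∀ {Γ φ ψ} → Deriv L T Γ (φ ∧ᶠ ψ) → Deriv L T Γ φ
  ∧E₂  : ∀ {Γ φ ψ} → Deriv L T Γ (φ ∧ᶠ ψ) → Deriv L T Γ ψ
  ∨I₁  : ∀ {Γ φ ψ} → Deriv L T Γ φ → Deriv L T Γ (φ ∨ᶠ ψ)
  ∨I₂  : ∀ {Γ φ ψ} → Deriv L T Γ ψ → Deriv L T Γ (φ ∨ᶠ ψ)
  ∨E   : ∀ {Γ φ ψ χ} → Deriv L T Γ (φ ∨ᶠ ψ) → Deriv L T (φ ∷ Γ) χ →
         Deriv L T (ψ ∷ Γ) χ → Deriv L T Γ χ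
  ⇒I   : ∀ {Γ φ ψ} → Deriv L T (φ ∷ Γ) ψ → Deriv L T Γ (φ ⇒ ψ)
  ⇒E   : ∀ {Γ φ ψ} → Deriv L T Γ (φ ⇒ ψ) → Deriv L T Γ φ → Deriv L T Γ ψ
  ∀I   : ∀ {Γ φ} → Deriv L T (map weaken Γ) φ → Deriv L T Γ (∀ᶠ φ)
  ∀E   : ∀ {Γ φ} → Deriv L T Γ (∀ᶠ φ) → (t : Term) → Deriv L T Γ (φ [ t ]₀)
  ∃I   : ∀ {Γ φ} → (t : Term) → Deriv L T Γ (φ [ t ]₀) → Deriv L T Γ (∃ᶠ φ)
  ∃E   : ∀ {Γ φ ψ} → Deriv L T Γ (∃ᶠ φ) →
         Deriv L T (φ ∷ map weaken Γ) (weaken ψ) → Deriv L T Γ ψ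
  ≐refl  : ∀ {Γ} (t : Term) → Deriv L T Γ (t ≐ t)
  ≐subst : ∀ {Γ t u} (φ : Formula) → Deriv L T Γ (t ≐ u) →
           Deriv L T Γ (φ [ t ]₀) → Deriv L T Γ (φ [ u ]₀)
  lem  : ∀ {Γ} → L ≡ classical → (φ : Formula) → Deriv L T Γ (φ ∨ᶠ ¬ᶠ φ)

Consistent : Logic → Theory → Set
Consistent L T = ¬ Deriv L T [] ⊥ᶠ

Equiconsistent : Logic → Theory → Logic → Theory → Set
Equiconsistent L T L' T' = (Consistent L T → Consistent L' T') × (Consistent L' T' → Consistent L T)

module Submission where

-- Easy direction: NF proves |V| = |P(V)| (V = P(V) when everything is a set,
-- and the diagonal {⟨x,x⟩} is a bijection), so derivations in
-- NFU + |V| = |P(V)| are derivations in NF (module EasyDirection).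
--
-- Hard direction: inside NFU + |V| = |P(V)| take the bijection f from the
-- objects onto the sets and read NF through it: everything counts as a set
-- and x ∈ y becomes ∃w (⟨y,w⟩ ∈ f ∧ x ∈ w).  Extensionality comes from injectivity of f.
-- Interpreted comprehension is not stratified, as f occurs at every type;
-- replacing f at type n by a new parameter f_n of type n + 2 repairs this
-- (splitInterp, separate), comprehension then yields a set A once every f_n is
-- set back to f, and the preimage of A under f is the object sought.

open import Defs
open import Function using (_∘_)
open import Data.Product using (_×_; _,_; Σ; proj₁; proj₂)
open import Data.Nat using (ℕ; zero; suc; _+_; _≤_; _<_; _⊓_; _⊔_; s≤s)
open import Data.Nat.Properties using (m≤n⇒m⊓n≡m; m⊓n≤n; m⊔n≤o⇒m≤o; m⊔n≤o⇒n≤o; ≤-reflexive)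
open import Data.Sum using (inj₁; inj₂)
open import Data.Unit using (tt)
open import Data.List using (List; []; _∷_; map; _++_)
open import Data.List.Membership.Propositional using (_∈_)
open import Data.List.Membership.Propositional.Properties using (∈-map⁺; ∈-++⁺ˡ; ∈-++⁺ʳ)
open import Data.List.Relation.Unary.Any using (here; there)
open import Relation.Binary.PropositionalEquality
  using (_≡_; refl; sym; trans; cong; cong₂; subst; subst₂; _≗_; module ≡-Reasoning)

subT-cong : ∀ {σ σ'} → σ ≗ σ' → ∀ t → subT σ t ≡ subT σ' t
subT-cong e (var i)   = e i
subT-cong e ⟨ t , u ⟩ = cong₂ ⟨_,_⟩ (subT-cong e t) (subT-cong e u)

extS-cong : ∀ {σ σ'} → σ ≗ σ' → extS σ ≗ extS σ'
extS-cong e zero    = refl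
extS-cong e (suc i) = cong (renT suc) (e i)

subF-cong : ∀ {σ σ'} → σ ≗ σ' → ∀ φ → subF σ φ ≡ subF σ' φ
subF-cong e (t ∈ₛ u) = cong₂ _∈ₛ_ (subT-cong e t) (subT-cong e u)
subF-cong e (t ≐ u)  = cong₂ _≐_ (subT-cong e t) (subT-cong e u)
subF-cong e (S t)    = cong S (subT-cong e t)
subF-cong e ⊥ᶠ       = refl
subF-cong e (φ ∧ᶠ ψ) = cong₂ _∧ᶠ_ (subF-cong e φ) (subF-cong e ψ)
subF-cong e (φ ∨ᶠ ψ) = cong₂ _∨ᶠ_ (subF-cong e φ) (subF-cong e ψ)
subF-cong e (φ ⇒ ψ)  = cong₂ _⇒_ (subF-cong e φ) (subF-cong e ψ)
subF-cong e (∀ᶠ φ)   = cong ∀ᶠ (subF-cong (extS-cong e) φ)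
subF-cong e (∃ᶠ φ)   = cong ∃ᶠ (subF-cong (extS-cong e) φ)

renT-as-sub : ∀ ρ t → renT ρ t ≡ subT (var ∘ ρ) t
renT-as-sub ρ (var i)   = refl
renT-as-sub ρ ⟨ t , u ⟩ = cong₂ ⟨_,_⟩ (renT-as-sub ρ t) (renT-as-sub ρ u)

extR-as-extS : ∀ ρ → var ∘ extR ρ ≗ extS (var ∘ ρ)
extR-as-extS ρ zero    = refl
extR-as-extS ρ (suc i) = refl

renF-as-sub : ∀ ρ φ → renF ρ φ ≡ subF (var ∘ ρ) φ
renF-as-sub ρ (t ∈ₛ u) = cong₂ _∈ₛ_ (renT-as-sub ρ t) (renT-as-sub ρ u)
renF-as-sub ρ (t ≐ u)  = cong₂ _≐_ (renT-as-sub ρ t) (renT-as-sub ρ u)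
renF-as-sub ρ (S t)    = cong S (renT-as-sub ρ t)
renF-as-sub ρ ⊥ᶠ       = refl
renF-as-sub ρ (φ ∧ᶠ ψ) = cong₂ _∧ᶠ_ (renF-as-sub ρ φ) (renF-as-sub ρ ψ)
renF-as-sub ρ (φ ∨ᶠ ψ) = cong₂ _∨ᶠ_ (renF-as-sub ρ φ) (renF-as-sub ρ ψ)
renF-as-sub ρ (φ ⇒ ψ)  = cong₂ _⇒_ (renF-as-sub ρ φ) (renF-as-sub ρ ψ)
renF-as-sub ρ (∀ᶠ φ)   = cong ∀ᶠ (trans (renF-as-sub (extR ρ) φ) (subF-cong (extR-as-extS ρ) φ))
renF-as-sub ρ (∃ᶠ φ)   = cong ∃ᶠ (trans (renF-as-sub (extR ρ) φ) (subF-cong (extR-as-extS ρ) φ))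

subT-weaken : ∀ σ t → subT (extS σ) (renT suc t) ≡ renT suc (subT σ t)
subT-weaken σ (var i)   = refl
subT-weaken σ ⟨ t , u ⟩ = cong₂ ⟨_,_⟩ (subT-weaken σ t) (subT-weaken σ u)

subT-∘ : ∀ σ₁ σ₂ t → subT σ₂ (subT σ₁ t) ≡ subT (subT σ₂ ∘ σ₁) t
subT-∘ σ₁ σ₂ (var i)   = refl
subT-∘ σ₁ σ₂ ⟨ t , u ⟩ = cong₂ ⟨_,_⟩ (subT-∘ σ₁ σ₂ t) (subT-∘ σ₁ σ₂ u)

extS-∘ : ∀ σ₁ σ₂ → subT (extS σ₂) ∘ extS σ₁ ≗ extS (subT σ₂ ∘ σ₁)
extS-∘ σ₁ σ₂ zero    = refl
extS-∘ σ₁ σ₂ (suc i) = subT-weaken σ₂ (σ₁ i)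

subF-∘ : ∀ σ₁ σ₂ φ → subF σ₂ (subF σ₁ φ) ≡ subF (subT σ₂ ∘ σ₁) φ
subF-∘ σ₁ σ₂ (t ∈ₛ u) = cong₂ _∈ₛ_ (subT-∘ σ₁ σ₂ t) (subT-∘ σ₁ σ₂ u)
subF-∘ σ₁ σ₂ (t ≐ u)  = cong₂ _≐_ (subT-∘ σ₁ σ₂ t) (subT-∘ σ₁ σ₂ u)
subF-∘ σ₁ σ₂ (S t)    = cong S (subT-∘ σ₁ σ₂ t)
subF-∘ σ₁ σ₂ ⊥ᶠ       = refl
subF-∘ σ₁ σ₂ (φ ∧ᶠ ψ) = cong₂ _∧ᶠ_ (subF-∘ σ₁ σ₂ φ) (subF-∘ σ₁ σ₂ ψ)
subF-∘ σ₁ σ₂ (φ ∨ᶠ ψ) = cong₂ _∨ᶠ_ (subF-∘ σ₁ σ₂ φ) (subF-∘ σ₁ σ₂ ψ)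
subF-∘ σ₁ σ₂ (φ ⇒ ψ)  = cong₂ _⇒_ (subF-∘ σ₁ σ₂ φ) (subF-∘ σ₁ σ₂ ψ)
subF-∘ σ₁ σ₂ (∀ᶠ φ)   = cong ∀ᶠ (trans (subF-∘ (extS σ₁) (extS σ₂) φ) (subF-cong (extS-∘ σ₁ σ₂) φ))
subF-∘ σ₁ σ₂ (∃ᶠ φ)   = cong ∃ᶠ (trans (subF-∘ (extS σ₁) (extS σ₂) φ) (subF-cong (extS-∘ σ₁ σ₂) φ))

subT-id : ∀ t → subT var t ≡ t
subT-id (var i)   = refl
subT-id ⟨ t , u ⟩ = cong₂ ⟨_,_⟩ (subT-id t) (subT-id u)

extS-id : extS var ≗ var
extS-id zero    = refl
extS-id (suc i) = refl

subF-id : ∀ φ → subF var φ ≡ φ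
subF-id (t ∈ₛ u) = cong₂ _∈ₛ_ (subT-id t) (subT-id u)
subF-id (t ≐ u)  = cong₂ _≐_ (subT-id t) (subT-id u)
subF-id (S t)    = cong S (subT-id t)
subF-id ⊥ᶠ       = refl
subF-id (φ ∧ᶠ ψ) = cong₂ _∧ᶠ_ (subF-id φ) (subF-id ψ)
subF-id (φ ∨ᶠ ψ) = cong₂ _∨ᶠ_ (subF-id φ) (subF-id ψ)
subF-id (φ ⇒ ψ)  = cong₂ _⇒_ (subF-id φ) (subF-id ψ)
subF-id (∀ᶠ φ)   = cong ∀ᶠ (trans (subF-cong extS-id φ) (subF-id φ))
subF-id (∃ᶠ φ)   = cong ∃ᶠ (trans (subF-cong extS-id φ) (subF-id φ))

subF-fuse : ∀ σ₁ σ₂ {σ} φ → subT σ₂ ∘ σ₁ ≗ σ → subF σ₂ (subF σ₁ φ) ≡ subF σ φ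
subF-fuse σ₁ σ₂ φ e = trans (subF-∘ σ₁ σ₂ φ) (subF-cong e φ)

subF-renF : ∀ σ ρ {σ'} φ → σ ∘ ρ ≗ σ' → subF σ (renF ρ φ) ≡ subF σ' φ
subF-renF σ ρ φ e = trans (cong (subF σ) (renF-as-sub ρ φ)) (subF-fuse _ σ φ e)


-- Membership read through a map f:  u ∈[ f ] v  says  ∃w (⟨v,w⟩ ∈ f ∧ u ∈ w),
-- i.e. u belongs to the set that f assigns to v.
infix 7 _∈[_]_
_∈[_]_ : Term → Term → Term → Formula
u ∈[ f ] v = ∃ᶠ (⟨ renT suc v , var 0 ⟩ ∈ₛ renT suc f ∧ᶠ renT suc u ∈ₛ var 0)

subF-∈[] : ∀ σ u f v → subF σ (u ∈[ f ] v) ≡ subT σ u ∈[ subT σ f ] subT σ v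
subF-∈[] σ u f v =
  cong ∃ᶠ (cong₂ _∧ᶠ_ (cong₂ _∈ₛ_ (cong₂ ⟨_,_⟩ (subT-weaken σ v) refl) (subT-weaken σ f))
                     (cong₂ _∈ₛ_ (subT-weaken σ u) refl))

-- The interpretation of NF relative to the map f = var j: membership is read
-- through f and every object counts as a set.
interp : ℕ → Formula → Formula
interp j (u ∈ₛ v) = u ∈[ var j ] v
interp j (u ≐ v)  = u ≐ v
interp j (S t)    = t ≐ t
interp j ⊥ᶠ       = ⊥ᶠ
interp j (φ ∧ᶠ ψ) = interp j φ ∧ᶠ interp j ψ
interp j (φ ∨ᶠ ψ) = interp j φ ∨ᶠ interp j ψ
interp j (φ ⇒ ψ)  = interp j φ ⇒ interp j ψ
interp j (∀ᶠ φ)   = ∀ᶠ (interp (suc j) φ)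
interp j (∃ᶠ φ)   = ∃ᶠ (interp (suc j) φ)

interp-sub : ∀ σ j {j'} φ → σ j ≡ var j' → subF σ (interp j φ) ≡ interp j' (subF σ φ)
interp-sub σ j (u ∈ₛ v) e = trans (subF-∈[] σ u (var j) v) (cong (λ f → subT σ u ∈[ f ] subT σ v) e)
interp-sub σ j (u ≐ v)  e = refl
interp-sub σ j (S t)    e = refl
interp-sub σ j ⊥ᶠ       e = refl
interp-sub σ j (φ ∧ᶠ ψ) e = cong₂ _∧ᶠ_ (interp-sub σ j φ e) (interp-sub σ j ψ e)
interp-sub σ j (φ ∨ᶠ ψ) e = cong₂ _∨ᶠ_ (interp-sub σ j φ e) (interp-sub σ j ψ e)
interp-sub σ j (φ ⇒ ψ)  e = cong₂ _⇒_ (interp-sub σ j φ e) (interp-sub σ j ψ e)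
interp-sub σ j (∀ᶠ φ)   e = cong ∀ᶠ (interp-sub (extS σ) (suc j) φ (cong (renT suc) e))
interp-sub σ j (∃ᶠ φ)   e = cong ∃ᶠ (interp-sub (extS σ) (suc j) φ (cong (renT suc) e))

interp-ren : ∀ ρ j φ → renF ρ (interp j φ) ≡ interp (ρ j) (renF ρ φ)
interp-ren ρ j φ = begin
  renF ρ (interp j φ)              ≡⟨ renF-as-sub ρ (interp j φ) ⟩
  subF (var ∘ ρ) (interp j φ)      ≡⟨ interp-sub (var ∘ ρ) j φ refl ⟩
  interp (ρ j) (subF (var ∘ ρ) φ)  ≡⟨ cong (interp (ρ j)) (renF-as-sub ρ φ) ⟨
  interp (ρ j) (renF ρ φ)          ∎
  where open ≡-Reasoning

interp-inst : ∀ j φ t → interp (suc j) φ [ t ]₀ ≡ interp j (φ [ t ]₀)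
interp-inst j φ t = interp-sub (t ∷ₑ var) (suc j) φ refl

module Interpretation {L : Logic} {T T' : Theory} (Hyp : ℕ → Formula)
  (Hyp-weaken : ∀ j → weaken (Hyp j) ≡ Hyp (suc j))
  (interp-axiom : ∀ {Δ} j {φ} → T φ → Hyp j ∈ Δ → Deriv L T' Δ (interp j φ)) where

  context : ℕ → List Formula → List Formula
  context j Γ = map (interp j) Γ ++ Hyp j ∷ []

  context-weaken : ∀ j Γ → map weaken (context j Γ) ≡ context (suc j) (map weaken Γ)
  context-weaken j []      = cong (_∷ []) (Hyp-weaken j)
  context-weaken j (φ ∷ Γ) = cong₂ _∷_ (interp-ren suc j φ) (context-weaken j Γ)

  interpDeriv : ∀ {Γ φ} j → Deriv L T Γ φ → Deriv L T' (context j Γ) (interp j φ)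
  interpDeriv j (hyp m)        = hyp (∈-++⁺ˡ (∈-map⁺ (interp j) m))
  interpDeriv {Γ} j (ax a)     = interp-axiom j a (∈-++⁺ʳ (map (interp j) Γ) (here refl))
  interpDeriv j (⊥E d)         = ⊥E (interpDeriv j d)
  interpDeriv j (∧I d e)       = ∧I (interpDeriv j d) (interpDeriv j e)
  interpDeriv j (∧E₁ d)        = ∧E₁ (interpDeriv j d)
  interpDeriv j (∧E₂ d)        = ∧E₂ (interpDeriv j d)
  interpDeriv j (∨I₁ d)        = ∨I₁ (interpDeriv j d)
  interpDeriv j (∨I₂ d)        = ∨I₂ (interpDeriv j d)
  interpDeriv j (∨E d e₁ e₂)   = ∨E (interpDeriv j d) (interpDeriv j e₁) (interpDeriv j e₂)
  interpDeriv j (⇒I d)         = ⇒I (interpDeriv j d)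
  interpDeriv j (⇒E d e)       = ⇒E (interpDeriv j d) (interpDeriv j e)
  interpDeriv {Γ} j (∀I d)     =
    ∀I (subst (λ Δ → Deriv L T' Δ _) (sym (context-weaken j Γ)) (interpDeriv (suc j) d))
  interpDeriv j (∀E {φ = φ} d t) = subst (Deriv L T' _) (interp-inst j φ t) (∀E (interpDeriv j d) t)
  interpDeriv j (∃I {φ = φ} t d) = ∃I t (subst (Deriv L T' _) (sym (interp-inst j φ t)) (interpDeriv j d))
  interpDeriv {Γ} j (∃E {φ = φ} {ψ = ψ} d e) =
    ∃E (interpDeriv j d)
       (subst₂ (Deriv L T') (cong (interp (suc j) φ ∷_) (sym (context-weaken j Γ)))
               (sym (interp-ren suc j ψ)) (interpDeriv (suc j) e))
  interpDeriv j (≐refl t)      = ≐refl t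
  interpDeriv j (≐subst {t = t} {u = u} φ e d) =
    subst (Deriv L T' _) (interp-inst j φ u)
      (≐subst (interp (suc j) φ) (interpDeriv j e)
              (subst (Deriv L T' _) (sym (interp-inst j φ t)) (interpDeriv j d)))
  interpDeriv j (lem p φ)      = lem p (interp j φ)

  consistency-reflected : Deriv L T' [] (∃ᶠ (Hyp 0)) → Consistent L T' → Consistent L T
  consistency-reflected hasF con d = con (∃E hasF (interpDeriv 0 d))

module AxiomsDerivable {L : Logic} {T T' : Theory}
  (derivable : ∀ {Γ φ} → T' φ → Deriv L T Γ φ) where

  liftDeriv : ∀ {Γ φ} → Deriv L T' Γ φ → Deriv L T Γ φ
  liftDeriv (hyp m)          = hyp m
  liftDeriv (ax a)           = derivable a
  liftDeriv (⊥E d)           = ⊥E (liftDeriv d)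
  liftDeriv (∧I d e)         = ∧I (liftDeriv d) (liftDeriv e)
  liftDeriv (∧E₁ d)          = ∧E₁ (liftDeriv d)
  liftDeriv (∧E₂ d)          = ∧E₂ (liftDeriv d)
  liftDeriv (∨I₁ d)          = ∨I₁ (liftDeriv d)
  liftDeriv (∨I₂ d)          = ∨I₂ (liftDeriv d)
  liftDeriv (∨E d e₁ e₂)     = ∨E (liftDeriv d) (liftDeriv e₁) (liftDeriv e₂)
  liftDeriv (⇒I d)           = ⇒I (liftDeriv d)
  liftDeriv (⇒E d e)         = ⇒E (liftDeriv d) (liftDeriv e)
  liftDeriv (∀I d)           = ∀I (liftDeriv d)
  liftDeriv (∀E d t)         = ∀E (liftDeriv d) t
  liftDeriv (∃I t d)         = ∃I t (liftDeriv d)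
  liftDeriv (∃E d e)         = ∃E (liftDeriv d) (liftDeriv e)
  liftDeriv (≐refl t)        = ≐refl t
  liftDeriv (≐subst φ e d)   = ≐subst φ (liftDeriv e) (liftDeriv d)
  liftDeriv (lem p φ)        = lem p φ

  consistency-transferred : Consistent L T → Consistent L T'
  consistency-transferred con d = con (liftDeriv d)

module Rules {L : Logic} {T : Theory} where

  infix 3 _⊢_
  _⊢_ : List Formula → Formula → Set
  Γ ⊢ φ = Deriv L T Γ φ

  up : ∀ {Γ φ} → φ ∈ Γ → weaken φ ∈ map weaken Γ
  up = ∈-map⁺ weaken

  h0 : ∀ {Γ φ} → φ ∷ Γ ⊢ φ
  h0 = hyp (here refl)

  h1 : ∀ {Γ φ ψ} → ψ ∷ φ ∷ Γ ⊢ φ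
  h1 = hyp (there (here refl))

  ≐-sym : ∀ {Γ} a b → Γ ⊢ var a ≐ var b → Γ ⊢ var b ≐ var a
  ≐-sym a b e = ≐subst (var 0 ≐ var (suc a)) e (≐refl (var a))

  ≐-trans : ∀ {Γ} a b c → Γ ⊢ var a ≐ var b → Γ ⊢ var b ≐ var c → Γ ⊢ var a ≐ var c
  ≐-trans a b c e₁ e₂ = ≐subst (var (suc a) ≐ var 0) e₂ e₁

  ∈-substʳ : ∀ {Γ} x a b → Γ ⊢ var a ≐ var b → Γ ⊢ var x ∈ₛ var a → Γ ⊢ var x ∈ₛ var b
  ∈-substʳ x a b e d = ≐subst (var (suc x) ∈ₛ var 0) e d

module NFURules {L : Logic} {ψ : Formula} where
  open Rules {L} {NFUAxiom ⊕ ψ}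

  extensionality : ∀ {Γ} a b → Γ ⊢ S (var a) → Γ ⊢ S (var b) →
    Γ ⊢ ∀ᶠ (var 0 ∈ₛ var (suc a) ⇔ᶠ var 0 ∈ₛ var (suc b)) → Γ ⊢ var a ≐ var b
  extensionality a b sa sb same = ⇒E (∀E (∀E (ax (inj₁ ext)) (var a)) (var b)) (∧I sa (∧I sb same))

  pairing : ∀ {Γ} a b c d → Γ ⊢ ⟨ var a , var b ⟩ ≐ ⟨ var c , var d ⟩ → Γ ⊢ var a ≐ var c ∧ᶠ var b ≐ var d
  pairing a b c d e = ⇒E (∀E (∀E (∀E (∀E (ax (inj₁ pair)) (var a)) (var b)) (var c)) (var d)) e

total functional injective setValued ontoSets Bij : ℕ → Formula
total k      = ∀ᶠ (∃ᶠ (⟨ var 1 , var 0 ⟩ ∈ₛ var (2 + k)))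
functional k = ∀ᶠ (∀ᶠ (∀ᶠ ((⟨ var 2 , var 1 ⟩ ∈ₛ var (3 + k) ∧ᶠ ⟨ var 2 , var 0 ⟩ ∈ₛ var (3 + k)) ⇒ var 1 ≐ var 0)))
injective k  = ∀ᶠ (∀ᶠ (∀ᶠ ((⟨ var 2 , var 0 ⟩ ∈ₛ var (3 + k) ∧ᶠ ⟨ var 1 , var 0 ⟩ ∈ₛ var (3 + k)) ⇒ var 2 ≐ var 1)))
setValued k  = ∀ᶠ (∀ᶠ (⟨ var 1 , var 0 ⟩ ∈ₛ var (2 + k) ⇒ S (var 0)))
ontoSets k   = ∀ᶠ (S (var 0) ⇒ ∃ᶠ (⟨ var 0 , var 1 ⟩ ∈ₛ var (2 + k)))
Bij k        = total k ∧ᶠ functional k ∧ᶠ injective k ∧ᶠ setValued k ∧ᶠ ontoSets k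

module BijRules {L : Logic} {T : Theory} where
  open Rules {L} {T}

  image : ∀ {Γ} k x → Bij k ∈ Γ → Γ ⊢ ∃ᶠ (⟨ var (suc x) , var 0 ⟩ ∈ₛ var (suc k))
  image k x m = ∀E (∧E₁ (hyp m)) (var x)

  image-unique : ∀ {Γ} k x a b → Bij k ∈ Γ → Γ ⊢ ⟨ var x , var a ⟩ ∈ₛ var k →
    Γ ⊢ ⟨ var x , var b ⟩ ∈ₛ var k → Γ ⊢ var a ≐ var b
  image-unique k x a b m d₁ d₂ = ⇒E (∀E (∀E (∀E (∧E₁ (∧E₂ (hyp m))) (var x)) (var a)) (var b)) (∧I d₁ d₂)

  preimage-unique : ∀ {Γ} k x y a → Bij k ∈ Γ → Γ ⊢ ⟨ var x , var a ⟩ ∈ₛ var k →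
    Γ ⊢ ⟨ var y , var a ⟩ ∈ₛ var k → Γ ⊢ var x ≐ var y
  preimage-unique k x y a m d₁ d₂ = ⇒E (∀E (∀E (∀E (∧E₁ (∧E₂ (∧E₂ (hyp m)))) (var x)) (var y)) (var a)) (∧I d₁ d₂)

  image-isSet : ∀ {Γ} k x a → Bij k ∈ Γ → Γ ⊢ ⟨ var x , var a ⟩ ∈ₛ var k → Γ ⊢ S (var a)
  image-isSet k x a m d = ⇒E (∀E (∀E (∧E₁ (∧E₂ (∧E₂ (∧E₂ (hyp m))))) (var x)) (var a)) d

  preimage : ∀ {Γ} k a → Bij k ∈ Γ → Γ ⊢ S (var a) → Γ ⊢ ∃ᶠ (⟨ var 0 , var (suc a) ⟩ ∈ₛ var (suc k))
  preimage k a m d = ⇒E (∀E (∧E₂ (∧E₂ (∧E₂ (∧E₂ (hyp m))))) (var a)) d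

  -- z is an interpreted member of x iff it is a member of the image a of x.
  -- (For elimination ⟨x,a⟩ ∈ f is an assumption, since it is used under the
  -- binder of ∈[].)
  ∈[]-intro : ∀ {Γ} k x a z → Γ ⊢ ⟨ var x , var a ⟩ ∈ₛ var k → Γ ⊢ var z ∈ₛ var a →
    Γ ⊢ var z ∈[ var k ] var x
  ∈[]-intro k x a z d e = ∃I (var a) (∧I d e)

  ∈[]-elim : ∀ {Γ} k x a z → Bij k ∈ Γ → (⟨ var x , var a ⟩ ∈ₛ var k) ∈ Γ →
    Γ ⊢ var z ∈[ var k ] var x → Γ ⊢ var z ∈ₛ var a
  ∈[]-elim k x a z m p d =
    ∃E d (∈-substʳ (suc z) 0 (suc a)
           (image-unique (suc k) (suc x) 0 (suc a) (there (up m)) (∧E₁ h0) (hyp (there (up p))))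
           (∧E₂ h0))

  image-transfer : ∀ {Γ} k x y a b z → Bij k ∈ Γ →
    (⟨ var x , var a ⟩ ∈ₛ var k) ∈ Γ → (⟨ var y , var b ⟩ ∈ₛ var k) ∈ Γ →
    Γ ⊢ var z ∈[ var k ] var x ⇒ var z ∈[ var k ] var y → Γ ⊢ var z ∈ₛ var a → Γ ⊢ var z ∈ₛ var b
  image-transfer k x y a b z m pa pb x⊆y za = ∈[]-elim k y b z m pb (⇒E x⊆y (∈[]-intro k x a z (hyp pa) za))

sameMembers : ℕ → ℕ → ℕ → Formula
sameMembers k x y = ∀ᶠ (var 0 ∈[ var (suc k) ] var (suc x) ⇔ᶠ var 0 ∈[ var (suc k) ] var (suc y))

NFU+card : Theory
NFU+card = NFUAxiom ⊕ cardAx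

module InterpretedAxioms {L : Logic} where
  open Rules {L} {NFU+card}
  open NFURules {L} {cardAx}
  open BijRules {L} {NFU+card}

  -- Objects with the same interpreted members have coextensive images, hence
  -- equal images by extensionality, hence are equal by injectivity of f.
  interp-coext : ∀ {Γ} k x y a b → Bij k ∈ Γ →
    (⟨ var x , var a ⟩ ∈ₛ var k) ∈ Γ → (⟨ var y , var b ⟩ ∈ₛ var k) ∈ Γ →
    (var x ≐ var x ∧ᶠ var y ≐ var y ∧ᶠ sameMembers k x y) ∈ Γ → Γ ⊢ var x ≐ var y
  interp-coext {Γ} k x y a b m pa pb pxy = preimage-unique k x y a m (hyp pa) ⟨y,a⟩∈f
    where
    x⇔y : ∀ {χ} → χ ∷ map weaken Γ ⊢ var 0 ∈[ var (suc k) ] var (suc x) ⇔ᶠ var 0 ∈[ var (suc k) ] var (suc y)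
    x⇔y = ∀E (∧E₂ (∧E₂ (hyp (there (up pxy))))) (var 0)

    sameImages : Γ ⊢ ∀ᶠ (var 0 ∈ₛ var (suc a) ⇔ᶠ var 0 ∈ₛ var (suc b))
    sameImages = ∀I (∧I
      (⇒I (image-transfer (suc k) (suc x) (suc y) (suc a) (suc b) 0 (there (up m))
             (there (up pa)) (there (up pb)) (∧E₁ x⇔y) h0))
      (⇒I (image-transfer (suc k) (suc y) (suc x) (suc b) (suc a) 0 (there (up m))
             (there (up pb)) (there (up pa)) (∧E₂ x⇔y) h0)))

    a≐b : Γ ⊢ var a ≐ var b
    a≐b = extensionality a b (image-isSet k x a m (hyp pa)) (image-isSet k y b m (hyp pb)) sameImages

    ⟨y,a⟩∈f : Γ ⊢ ⟨ var y , var a ⟩ ∈ₛ var k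
    ⟨y,a⟩∈f = ≐subst (⟨ var (suc y) , var 0 ⟩ ∈ₛ var (suc k)) (≐-sym a b a≐b) (hyp pb)

  ext-interp : ∀ {Γ} j → Bij j ∈ Γ → Γ ⊢ interp j extAx
  ext-interp j m =
    ∀I (∀I (⇒I (∃E (image (2 + j) 1 m₂) (∃E (image (3 + j) 1 (there (up m₂)))
      (interp-coext (4 + j) 3 2 1 0 (there (up (there (up m₂))))
        (there (up (here refl))) (here refl) (there (up (there (up (here refl))))))))))
    where m₂ = there (up (up m))

  -- The pairing axiom mentions no membership, so it is its own interpretation.
  pair-interp : ∀ {Γ} j → Γ ⊢ interp j pairAx
  pair-interp j = ax (inj₁ pair)

  sethood-interp : ∀ {Γ} j → Γ ⊢ interp j sethoodAx
  sethood-interp j = ∀I (∀I (⇒I (≐refl (var 1))))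

  allSets-interp : ∀ {Γ} j → Γ ⊢ interp j allSetsAx
  allSets-interp j = ∀I (≐refl (var 0))

TermTy-ren : ∀ {ρ σ σ' t n} → σ' ∘ ρ ≗ σ → TermTy σ t n → TermTy σ' (renT ρ t) n
TermTy-ren {ρ} {σ' = σ'} e (tvar i) = subst (TermTy σ' (var (ρ i))) (e i) (tvar (ρ i))
TermTy-ren e (tpair a b)            = tpair (TermTy-ren e a) (TermTy-ren e b)

TermTy-weaken : ∀ {σ t n} k → TermTy σ t n → TermTy (k ∷ₑ σ) (renT suc t) n
TermTy-weaken k = TermTy-ren (λ _ → refl)

atomBound : ∀ σ φ → StratF σ φ → ℕ
atomBound σ (u ∈ₛ v) (n , _) = n
atomBound σ (u ≐ v)  _       = 0
atomBound σ (S t)    _       = 0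
atomBound σ ⊥ᶠ       _       = 0
atomBound σ (φ ∧ᶠ ψ) (p , q) = atomBound σ φ p ⊔ atomBound σ ψ q
atomBound σ (φ ∨ᶠ ψ) (p , q) = atomBound σ φ p ⊔ atomBound σ ψ q
atomBound σ (φ ⇒ ψ)  (p , q) = atomBound σ φ p ⊔ atomBound σ ψ q
atomBound σ (∀ᶠ φ)   (k , p) = atomBound (k ∷ₑ σ) φ p
atomBound σ (∃ᶠ φ)   (k , p) = atomBound (k ∷ₑ σ) φ p

StratF-ren : ∀ ρ σ σ' φ → σ' ∘ ρ ≗ σ → (p : StratF σ φ) →
  Σ (StratF σ' (renF ρ φ)) λ p' → atomBound σ' (renF ρ φ) p' ≡ atomBound σ φ p
StratF-ren ρ σ σ' (u ∈ₛ v) e (n , a , b) = (n , TermTy-ren e a , TermTy-ren e b) , refl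
StratF-ren ρ σ σ' (u ≐ v)  e (n , a , b) = (n , TermTy-ren e a , TermTy-ren e b) , refl
StratF-ren ρ σ σ' (S t)    e (n , a)     = (n , TermTy-ren e a) , refl
StratF-ren ρ σ σ' ⊥ᶠ       e p           = tt , refl
StratF-ren ρ σ σ' (φ ∧ᶠ ψ) e (p , q) with StratF-ren ρ σ σ' φ e p | StratF-ren ρ σ σ' ψ e q
... | p' , e₁ | q' , e₂ = (p' , q') , cong₂ _⊔_ e₁ e₂
StratF-ren ρ σ σ' (φ ∨ᶠ ψ) e (p , q) with StratF-ren ρ σ σ' φ e p | StratF-ren ρ σ σ' ψ e q
... | p' , e₁ | q' , e₂ = (p' , q') , cong₂ _⊔_ e₁ e₂
StratF-ren ρ σ σ' (φ ⇒ ψ)  e (p , q) with StratF-ren ρ σ σ' φ e p | StratF-ren ρ σ σ' ψ e q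
... | p' , e₁ | q' , e₂ = (p' , q') , cong₂ _⊔_ e₁ e₂
StratF-ren ρ σ σ' (∀ᶠ φ)   e (k , p) with StratF-ren (extR ρ) (k ∷ₑ σ) (k ∷ₑ σ') φ (λ { zero → refl ; (suc i) → e i }) p
... | p' , e₁ = (k , p') , e₁
StratF-ren ρ σ σ' (∃ᶠ φ)   e (k , p) with StratF-ren (extR ρ) (k ∷ₑ σ) (k ∷ₑ σ') φ (λ { zero → refl ; (suc i) → e i }) p
... | p' , e₁ = (k , p') , e₁

splitInterp : (F : ℕ → Term) (σ : ℕ → ℕ) (φ : Formula) → StratF σ φ → Formula
splitInterp F σ (u ∈ₛ v) (n , _) = u ∈[ F n ] v
splitInterp F σ (u ≐ v)  _       = u ≐ v
splitInterp F σ (S t)    _       = t ≐ t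
splitInterp F σ ⊥ᶠ       _       = ⊥ᶠ
splitInterp F σ (φ ∧ᶠ ψ) (p , q) = splitInterp F σ φ p ∧ᶠ splitInterp F σ ψ q
splitInterp F σ (φ ∨ᶠ ψ) (p , q) = splitInterp F σ φ p ∨ᶠ splitInterp F σ ψ q
splitInterp F σ (φ ⇒ ψ)  (p , q) = splitInterp F σ φ p ⇒ splitInterp F σ ψ q
splitInterp F σ (∀ᶠ φ)   (k , p) = ∀ᶠ (splitInterp (renT suc ∘ F) (k ∷ₑ σ) φ p)
splitInterp F σ (∃ᶠ φ)   (k , p) = ∃ᶠ (splitInterp (renT suc ∘ F) (k ∷ₑ σ) φ p)

splitInterp-sub : ∀ τ F σ φ p j → (∀ n → subT τ (F n) ≡ var j) →
  subF τ (splitInterp F σ φ p) ≡ interp j (subF τ φ)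
splitInterp-sub τ F σ (u ∈ₛ v) (n , _) j e =
  trans (subF-∈[] τ u (F n) v) (cong (λ f → subT τ u ∈[ f ] subT τ v) (e n))
splitInterp-sub τ F σ (u ≐ v)  p j e = refl
splitInterp-sub τ F σ (S t)    p j e = refl
splitInterp-sub τ F σ ⊥ᶠ       p j e = refl
splitInterp-sub τ F σ (φ ∧ᶠ ψ) (p , q) j e = cong₂ _∧ᶠ_ (splitInterp-sub τ F σ φ p j e) (splitInterp-sub τ F σ ψ q j e)
splitInterp-sub τ F σ (φ ∨ᶠ ψ) (p , q) j e = cong₂ _∨ᶠ_ (splitInterp-sub τ F σ φ p j e) (splitInterp-sub τ F σ ψ q j e)
splitInterp-sub τ F σ (φ ⇒ ψ)  (p , q) j e = cong₂ _⇒_ (splitInterp-sub τ F σ φ p j e) (splitInterp-sub τ F σ ψ q j e)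
splitInterp-sub τ F σ (∀ᶠ φ)   (k , p) j e =
  cong ∀ᶠ (splitInterp-sub (extS τ) _ (k ∷ₑ σ) φ p (suc j) (λ n → trans (subT-weaken τ (F n)) (cong (renT suc) (e n))))
splitInterp-sub τ F σ (∃ᶠ φ)   (k , p) j e =
  cong ∃ᶠ (splitInterp-sub (extS τ) _ (k ∷ₑ σ) φ p (suc j) (λ n → trans (subT-weaken τ (F n)) (cong (renT suc) (e n))))

-- The split interpretation is stratified as soon as each F n that is used
-- has type n + 2: in ∃w (⟨v,w⟩ ∈ F n ∧ u ∈ w) the types of u, v, w, F n are
-- n, n + 1, n + 1, n + 2.
splitInterp-stratified : ∀ F σ φ p B → atomBound σ φ p ≤ B →
  (∀ n → n ≤ B → TermTy σ (F n) (2 + n)) → StratF σ (splitInterp F σ φ p)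
splitInterp-stratified F σ (u ∈ₛ v) (n , tu , tv) B h hF =
  suc n , (suc n , tpair (TermTy-weaken (suc n) tv) (tvar 0) , TermTy-weaken (suc n) (hF n h))
        , (n , TermTy-weaken (suc n) tu , tvar 0)
splitInterp-stratified F σ (u ≐ v)  p B h hF = p
splitInterp-stratified F σ (S t)    (n , tt') B h hF = n , tt' , tt'
splitInterp-stratified F σ ⊥ᶠ       p B h hF = tt
splitInterp-stratified F σ (φ ∧ᶠ ψ) (p , q) B h hF =
  splitInterp-stratified F σ φ p B (m⊔n≤o⇒m≤o _ _ h) hF , splitInterp-stratified F σ ψ q B (m⊔n≤o⇒n≤o _ _ h) hF
splitInterp-stratified F σ (φ ∨ᶠ ψ) (p , q) B h hF =
  splitInterp-stratified F σ φ p B (m⊔n≤o⇒m≤o _ _ h) hF , splitInterp-stratified F σ ψ q B (m⊔n≤o⇒n≤o _ _ h) hF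
splitInterp-stratified F σ (φ ⇒ ψ)  (p , q) B h hF =
  splitInterp-stratified F σ φ p B (m⊔n≤o⇒m≤o _ _ h) hF , splitInterp-stratified F σ ψ q B (m⊔n≤o⇒n≤o _ _ h) hF
splitInterp-stratified F σ (∀ᶠ φ)   (k , p) B h hF =
  k , splitInterp-stratified _ (k ∷ₑ σ) φ p B h (λ n le → TermTy-weaken k (hF n le))
splitInterp-stratified F σ (∃ᶠ φ)   (k , p) B h hF =
  k , splitInterp-stratified _ (k ∷ₑ σ) φ p B h (λ n le → TermTy-weaken k (hF n le))

block : {A : Set} → ℕ → (ℕ → A) → (ℕ → A) → ℕ → A
block zero    a b = b
block (suc K) a b = a 0 ∷ₑ block K (a ∘ suc) b

block-ge : {A : Set} → ∀ K (a b : ℕ → A) i → block K a b (K + i) ≡ b i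
block-ge zero    a b i = refl
block-ge (suc K) a b i = block-ge K (a ∘ suc) b i

block-lt : {A : Set} → ∀ K (a b : ℕ → A) i → i < K → block K a b i ≡ a i
block-lt (suc K) a b zero    _       = refl
block-lt (suc K) a b (suc i) (s≤s h) = block-lt K (a ∘ suc) b i h

-- A formula derivable in every context stays derivable after its first K
-- free variables are renamed arbitrarily: generalise, then instantiate.
instantiate-prefix : ∀ {L T} K (a : ℕ → ℕ) θ → (∀ {Γ} → Deriv L T Γ θ) →
  ∀ {Γ} → Deriv L T Γ (subF (block K (var ∘ a) var) θ)
instantiate-prefix {L} {T} zero a θ d = subst (Deriv L T _) (sym (subF-id θ)) d
instantiate-prefix {L} {T} (suc K) a θ d =
  subst (Deriv L T _) (subF-fuse _ (block K (var ∘ a ∘ suc) var) θ instantiated)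
    (instantiate-prefix K (a ∘ suc) (θ [ var (K + a 0) ]₀) (∀E (∀I d) (var (K + a 0))))
  where
  instantiated : subT (block K (var ∘ a ∘ suc) var) ∘ (var (K + a 0) ∷ₑ var) ≗ block (suc K) (var ∘ a) var
  instantiated zero    = block-ge K (var ∘ a ∘ suc) var (a 0)
  instantiated (suc i) = refl

-- A stratified φ has a stratified companion χ
-- with K new parameters f_0, …, f_(K-1) right after the bound variable
-- z = var 0; setting every f_n to f = var j turns χ into interp (suc j) φ.
separate : ∀ j φ → Stratified φ → Σ ℕ λ K → Σ Formula λ χ →
  Stratified χ × subF (extS (block K (λ _ → var j) var)) χ ≡ interp (suc j) φ
separate j φ (σ , p) = K , χ , (σ' , χ-stratified) , χ-instance
  where
  -- every atom of φ has type at most B, so the copies f_0, …, f_B suffice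
  B K : ℕ
  B = atomBound σ φ p
  K = suc B

  -- the parameters of φ move up past the copies
  ρ : ℕ → ℕ
  ρ = extR (K +_)

  -- the copy f_n is var (1 + n) and has type n + 2
  σ' : ℕ → ℕ
  σ' = σ 0 ∷ₑ block K (2 +_) (σ ∘ suc)

  σ'-ρ : σ' ∘ ρ ≗ σ
  σ'-ρ zero    = refl
  σ'-ρ (suc i) = block-ge K (2 +_) (σ ∘ suc) i

  renamed : Σ (StratF σ' (renF ρ φ)) λ p' → atomBound σ' (renF ρ φ) p' ≡ B
  renamed = StratF-ren ρ σ σ' φ σ'-ρ p

  F : ℕ → Term
  F n = var (suc (n ⊓ B))

  n⊓B<K : ∀ n → n ⊓ B < K
  n⊓B<K n = s≤s (m⊓n≤n n B)

  F-typed : ∀ n → n ≤ B → TermTy σ' (F n) (2 + n)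
  F-typed n n≤B = subst (TermTy σ' (F n))
    (trans (block-lt K (2 +_) (σ ∘ suc) (n ⊓ B) (n⊓B<K n)) (cong (2 +_) (m≤n⇒m⊓n≡m n≤B)))
    (tvar (suc (n ⊓ B)))

  χ : Formula
  χ = splitInterp F σ' (renF ρ φ) (proj₁ renamed)

  χ-stratified : StratF σ' χ
  χ-stratified = splitInterp-stratified F σ' (renF ρ φ) (proj₁ renamed) B (≤-reflexive (proj₂ renamed)) F-typed

  τ : ℕ → Term
  τ = block K (λ _ → var j) var

  copies↦f : ∀ n → subT (extS τ) (F n) ≡ var (suc j)
  copies↦f n = cong (renT suc) (block-lt K (λ _ → var j) var (n ⊓ B) (n⊓B<K n))

  parameters-restored : extS τ ∘ ρ ≗ var
  parameters-restored zero    = refl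
  parameters-restored (suc i) = cong (renT suc) (block-ge K (λ _ → var j) var i)

  χ-instance : subF (extS τ) χ ≡ interp (suc j) φ
  χ-instance = begin
    subF (extS τ) χ                           ≡⟨ splitInterp-sub (extS τ) F σ' (renF ρ φ) (proj₁ renamed) (suc j) copies↦f ⟩
    interp (suc j) (subF (extS τ) (renF ρ φ)) ≡⟨ cong (interp (suc j)) (subF-renF (extS τ) ρ φ parameters-restored) ⟩
    interp (suc j) (subF var φ)               ≡⟨ cong (interp (suc j)) (subF-id φ) ⟩
    interp (suc j) φ                          ∎
    where open ≡-Reasoning

scShift-weaken : ∀ t → subT (var ∘ scShift) (renT suc t) ≡ renT suc (renT suc t)
scShift-weaken (var i)   = refl
scShift-weaken ⟨ t , u ⟩ = cong₂ ⟨_,_⟩ (scShift-weaken t) (scShift-weaken u)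

scAx-sub : ∀ τ χ → subF τ (scAx χ) ≡ scAx (subF (extS τ) χ)
scAx-sub τ χ = cong (λ X → ∃ᶠ (S (var 0) ∧ᶠ ∀ᶠ (var 0 ∈ₛ var 1 ⇔ᶠ X))) (begin
  subF (extS (extS τ)) (renF scShift χ)            ≡⟨ subF-renF (extS (extS τ)) scShift χ shift-past ⟩
  subF (subT (var ∘ scShift) ∘ extS τ) χ           ≡⟨ subF-∘ (extS τ) (var ∘ scShift) χ ⟨
  subF (var ∘ scShift) (subF (extS τ) χ)           ≡⟨ renF-as-sub scShift (subF (extS τ) χ) ⟨
  renF scShift (subF (extS τ) χ)                   ∎)
  where
  open ≡-Reasoning
  shift-past : extS (extS τ) ∘ scShift ≗ subT (var ∘ scShift) ∘ extS τ
  shift-past zero    = refl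
  shift-past (suc i) = sym (scShift-weaken (τ i))

subF-renF³ : ∀ σ ρ₁ ρ₂ ρ₃ ψ → subF σ (renF ρ₁ (renF ρ₂ (renF ρ₃ ψ))) ≡ subF (σ ∘ ρ₁ ∘ ρ₂ ∘ ρ₃) ψ
subF-renF³ σ ρ₁ ρ₂ ρ₃ ψ = begin
  subF σ (renF ρ₁ (renF ρ₂ (renF ρ₃ ψ)))  ≡⟨ subF-renF σ ρ₁ (renF ρ₂ (renF ρ₃ ψ)) (λ _ → refl) ⟩
  subF (σ ∘ ρ₁) (renF ρ₂ (renF ρ₃ ψ))     ≡⟨ subF-renF (σ ∘ ρ₁) ρ₂ (renF ρ₃ ψ) (λ _ → refl) ⟩
  subF (σ ∘ ρ₁ ∘ ρ₂) (renF ρ₃ ψ)          ≡⟨ subF-renF (σ ∘ ρ₁ ∘ ρ₂) ρ₃ ψ (λ _ → refl) ⟩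
  subF (σ ∘ ρ₁ ∘ ρ₂ ∘ ρ₃) ψ               ∎
  where open ≡-Reasoning

-- The defining formula ψ of a comprehension instance, weakened twice and
-- instantiated at the innermost variable: the two orders in which this
-- happens in preimage-comprehension give the same formula.
comprehension-body-agree : ∀ ψ →
  subF (var 0 ∷ₑ var) (renF (extR suc) (renF (extR suc) (renF scShift ψ)))
  ≡ subF (extS (var 0 ∷ₑ var)) (renF (extR (extR suc)) (renF (extR (extR suc)) (renF scShift ψ)))
comprehension-body-agree ψ =
  trans (subF-renF³ (var 0 ∷ₑ var) (extR suc) (extR suc) scShift ψ)
        (trans (subF-cong same ψ) (sym (subF-renF³ (extS (var 0 ∷ₑ var)) (extR (extR suc)) (extR (extR suc)) scShift ψ)))
  where
  same : (var 0 ∷ₑ var) ∘ extR suc ∘ extR suc ∘ scShift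
       ≗ extS (var 0 ∷ₑ var) ∘ extR (extR suc) ∘ extR (extR suc) ∘ scShift
  same zero    = refl
  same (suc i) = refl

scBody : Formula → Formula
scBody ψ = S (var 0) ∧ᶠ ∀ᶠ (var 0 ∈ₛ var 1 ⇔ᶠ renF scShift ψ)

module InterpretedComprehension {L : Logic} where
  open Rules {L} {NFU+card}
  open BijRules {L} {NFU+card}

  -- If a set A has exactly the members satisfying ψ, the object that f maps
  -- to A has exactly the interpreted members satisfying ψ.
  preimage-comprehension : ∀ {Γ} j ψ → Bij j ∈ Γ → Γ ⊢ scAx ψ →
    Γ ⊢ ∃ᶠ (var 0 ≐ var 0 ∧ᶠ ∀ᶠ (var 0 ∈[ var (2 + j) ] var 1 ⇔ᶠ renF scShift ψ))
  preimage-comprehension {Γ} j ψ m setA =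
    ∃E setA (∃E (preimage (suc j) 0 (there (up m)) (∧E₁ h0))
      (∃I (var 0) (∧I (≐refl (var 0)) (∀I (∧I (⇒I forward) (⇒I backward))))))
    where
    -- the context once A (var 2), its preimage x (var 1) and z (var 0) are bound
    Γz : List Formula
    Γz = map weaken (⟨ var 0 , var 1 ⟩ ∈ₛ var (2 + j) ∷ map weaken (scBody ψ ∷ map weaken Γ))

    -- ψ at z, as read off the definition of A and as demanded by the goal
    ψ-A ψ-goal : Formula
    ψ-A    = subF (var 0 ∷ₑ var) (renF (extR suc) (renF (extR suc) (renF scShift ψ)))
    ψ-goal = subF (extS (var 0 ∷ₑ var)) (renF (extR (extR suc)) (renF (extR (extR suc)) (renF scShift ψ)))

    m' : ∀ {χ} → Bij (3 + j) ∈ χ ∷ Γz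
    m' = there (up (there (up (there (up m)))))

    A-def : ∀ {χ} → χ ∷ Γz ⊢ var 0 ∈ₛ var 2 ⇔ᶠ ψ-A
    A-def = ∀E (∧E₂ (hyp (there (up (there (up (here refl))))))) (var 0)

    forward : var 0 ∈[ var (3 + j) ] var 1 ∷ Γz ⊢ ψ-goal
    forward = subst (_ ∷ Γz ⊢_) (comprehension-body-agree ψ)
      (⇒E (∧E₁ A-def) (∈[]-elim (3 + j) 1 2 0 m' (there (up (here refl))) h0))

    backward : ψ-goal ∷ Γz ⊢ var 0 ∈[ var (3 + j) ] var 1
    backward = ∈[]-intro (3 + j) 1 2 0 (hyp (there (up (here refl))))
      (⇒E (∧E₂ A-def) (subst (ψ-goal ∷ Γz ⊢_) (sym (comprehension-body-agree ψ)) h0))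

  -- Comprehension for a stratified φ, interpreted: comprehension for the
  -- separated formula χ, with all copies set back to f, yields the set A.
  sc-interp : ∀ {Γ} j φ → Stratified φ → Bij j ∈ Γ → Γ ⊢ interp j (scAx φ)
  sc-interp {Γ} j φ s m with separate j φ s
  ... | K , χ , χ-stratified , χ-instance =
    subst (Γ ⊢_) (cong (λ X → ∃ᶠ (var 0 ≐ var 0 ∧ᶠ ∀ᶠ (var 0 ∈[ var (2 + j) ] var 1 ⇔ᶠ X))) (interp-ren scShift (suc j) φ))
      (preimage-comprehension j (interp (suc j) φ) m setA)
    where
    setA : Γ ⊢ scAx (interp (suc j) φ)
    setA = subst (Γ ⊢_) (trans (scAx-sub (block K (λ _ → var j) var) χ) (cong scAx χ-instance))
                 (instantiate-prefix K (λ _ → j) (scAx χ) (ax (inj₁ (sc χ χ-stratified))))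

-- The matrix of |V| = |P(V)| below its quantifiers ∃V ∃P ∃f; in it f is
-- var 0, P is var 1 and V is var 2.
matrix∃ : Formula → Formula
matrix∃ (∃ᶠ φ) = φ
matrix∃ φ      = φ

cardBody : Formula
cardBody = matrix∃ (matrix∃ (matrix∃ cardAx))

-- the n-th conjunct of a right-nested conjunction (the last one for large n)
conjunct : Formula → ℕ → Formula
conjunct (φ ∧ᶠ ψ) zero    = φ
conjunct (φ ∧ᶠ ψ) (suc n) = conjunct ψ n
conjunct φ        _       = φ

module HardDirection {L : Logic} where
  open Rules {L} {NFU+card}
  open NFURules {L} {cardAx}
  open BijRules {L} {NFU+card}
  open InterpretedAxioms {L}
  open InterpretedComprehension {L}

  interp-axiom : ∀ {Γ} j {φ} → NFAxiom φ → Bij j ∈ Γ → Γ ⊢ interp j φ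
  interp-axiom j (inj₁ ext)      m = ext-interp j m
  interp-axiom j (inj₁ (sc φ s)) m = sc-interp j φ s m
  interp-axiom j (inj₁ pair)     m = pair-interp j
  interp-axiom j (inj₁ sethood)  m = sethood-interp j
  interp-axiom j (inj₂ refl)     m = allSets-interp j

  card⇒Bij : ∀ {Γ} → cardBody ∷ Γ ⊢ Bij 0
  card⇒Bij {Γ} = ∧I f-total (∧I f-functional (∧I f-injective (∧I f-setValued f-ontoSets)))
    where
    f-functional : cardBody ∷ Γ ⊢ functional 0
    f-functional = ∧E₁ (∧E₂ (∧E₂ (∧E₂ (∧E₂ (∧E₂ h0)))))

    f-injective : cardBody ∷ Γ ⊢ injective 0
    f-injective = ∧E₁ (∧E₂ (∧E₂ (∧E₂ (∧E₂ (∧E₂ (∧E₂ h0))))))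

    -- every x lies in V, and f is total on V
    f-total : cardBody ∷ Γ ⊢ total 0
    f-total = ∀I (∃E (⇒E (∀E (∧E₁ (∧E₂ (∧E₂ (∧E₂ (∧E₂ h0))))) (var 0)) x∈V) (∃I (var 0) (∧E₂ h0)))
      where
      x∈V : weaken cardBody ∷ map weaken Γ ⊢ var 0 ∈ₛ var 3
      x∈V = ⇒E (∧E₂ (∀E (∧E₂ (∧E₁ h0)) (var 0))) (≐refl (var 0))

    -- ⟨x,y⟩ ∈ f ⊆ V × P gives ⟨x,y⟩ = ⟨x',y'⟩ with y' ∈ P, so y = y' is a set
    f-setValued : cardBody ∷ Γ ⊢ setValued 0
    f-setValued = ∀I (∀I (⇒I (∃E (⇒E (∀E (∧E₁ (∧E₂ (∧E₂ (∧E₂ h1)))) ⟨ var 1 , var 0 ⟩) h0)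
      (∃E h0 (≐subst (S (var 0)) (≐-sym 2 0 (∧E₂ (pairing 3 2 1 0 (∧E₁ h0))))
        (∧E₁ (⇒E (∧E₁ (∀E (∧E₂ (∧E₁ (∧E₂ (hyp (there (there (there (here refl)))))))) (var 0)))
                 (∧E₂ (∧E₂ h0)))))))))

    -- every set y is a subset of V, so y ∈ P, which f reaches
    f-ontoSets : cardBody ∷ Γ ⊢ ontoSets 0
    f-ontoSets = ∀I (⇒I (⇒E (∀E (∧E₂ (∧E₂ (∧E₂ (∧E₂ (∧E₂ (∧E₂ (∧E₂ h1))))))) (var 0))
                            (⇒E (∧E₂ (∀E (∧E₂ (∧E₁ (∧E₂ h1))) (var 0))) (∧I h0 y⊆V))))
      where
      y⊆V : S (var 0) ∷ weaken cardBody ∷ map weaken Γ ⊢ ∀ᶠ (var 0 ∈ₛ var 1 ⇒ var 0 ∈ₛ var 4)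
      y⊆V = ∀I (⇒I (⇒E (∧E₂ (∀E (∧E₂ (∧E₁ (hyp (there (there (here refl)))))) (var 0))) (≐refl (var 0))))

  bijection-exists : [] ⊢ ∃ᶠ (Bij 0)
  bijection-exists = ∃E (ax (inj₂ refl)) (∃E h0 (∃E h0 (∃I (var 0) card⇒Bij)))

  consistency-reflected : Consistent L NFU+card → Consistent L NFAxiom
  consistency-reflected = Interpretation.consistency-reflected Bij (λ _ → refl) interp-axiom bijection-exists

module EasyDirection {L : Logic} where
  open Rules {L} {NFAxiom}
  open NFURules {L} {allSetsAx}

  V-def : ℕ → Formula
  V-def v = S (var v) ∧ᶠ ∀ᶠ (var 0 ∈ₛ var (suc v) ⇔ᶠ var 0 ≐ var 0)

  P-def : ℕ → ℕ → Formula
  P-def p v = S (var p) ∧ᶠ ∀ᶠ (var 0 ∈ₛ var (suc p) ⇔ᶠ (S (var 0) ∧ᶠ ∀ᶠ (var 0 ∈ₛ var 1 ⇒ var 0 ∈ₛ var (2 + v))))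

  diagonal-def : ℕ → Formula
  diagonal-def f = S (var f) ∧ᶠ ∀ᶠ (var 0 ∈ₛ var (suc f) ⇔ᶠ ∃ᶠ (var 1 ≐ ⟨ var 0 , var 0 ⟩))

  ∈V : ∀ {Γ v} → V-def v ∈ Γ → ∀ a → Γ ⊢ var a ∈ₛ var v
  ∈V mV a = ⇒E (∧E₂ (∀E (∧E₂ (hyp mV)) (var a))) (≐refl (var a))

  -- every object is a set, and a subset of V
  ∈P : ∀ {Γ p v} → P-def p v ∈ Γ → V-def v ∈ Γ → ∀ a → Γ ⊢ var a ∈ₛ var p
  ∈P mP mV a = ⇒E (∧E₂ (∀E (∧E₂ (hyp mP)) (var a)))
    (∧I (∀E (ax (inj₂ refl)) (var a)) (∀I (⇒I (∈V (there (up mV)) 0))))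

  ⟨a,a⟩∈diagonal : ∀ {Γ f} → diagonal-def f ∈ Γ → ∀ a → Γ ⊢ ⟨ var a , var a ⟩ ∈ₛ var f
  ⟨a,a⟩∈diagonal mf a = ⇒E (∧E₂ (∀E (∧E₂ (hyp mf)) ⟨ var a , var a ⟩)) (∃I (var a) (≐refl _))

  -- ⟨a,b⟩ = ⟨w,w⟩ forces a = w = b
  diagonal-≐ : ∀ {Γ f} → diagonal-def f ∈ Γ → ∀ a b → Γ ⊢ ⟨ var a , var b ⟩ ∈ₛ var f → Γ ⊢ var a ≐ var b
  diagonal-≐ {Γ} mf a b d = ∃E (⇒E (∧E₁ (∀E (∧E₂ (hyp mf)) ⟨ var a , var b ⟩)) d)
    (≐-trans (suc a) 0 (suc b) (∧E₁ components) (≐-sym (suc b) 0 (∧E₂ components)))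
    where
    components : ⟨ var (suc a) , var (suc b) ⟩ ≐ ⟨ var 0 , var 0 ⟩ ∷ map weaken Γ ⊢ var (suc a) ≐ var 0 ∧ᶠ var (suc b) ≐ var 0
    components = pairing (suc a) (suc b) 0 0 h0

  card-witness : ∀ {Γ} → diagonal-def 0 ∈ Γ → P-def 1 2 ∈ Γ → V-def 2 ∈ Γ → Γ ⊢ cardBody
  card-witness {Γ} mf mP mV =
    ∧I (hyp mV) (∧I (hyp mP) (∧I (∧E₁ (hyp mf))
      (∧I f⊆V×P (∧I f-total (∧I f-functional (∧I f-injective f-onto))))))
    where
    f⊆V×P : Γ ⊢ conjunct cardBody 3
    f⊆V×P = ∀I (⇒I (∃E (⇒E (∧E₁ (∀E (∧E₂ (hyp (there (up mf)))) (var 0))) h0)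
      (∃I (var 0) (∃I (var 0) (∧I h0 (∧I (∈V (there (up (there (up mV)))) 0)
                                         (∈P (there (up (there (up mP)))) (there (up (there (up mV)))) 0)))))))

    f-total : Γ ⊢ conjunct cardBody 4
    f-total = ∀I (⇒I (∃I (var 0) (∧I (∈P (there (up mP)) (there (up mV)) 0) (⟨a,a⟩∈diagonal (there (up mf)) 0))))

    f-functional : Γ ⊢ conjunct cardBody 5
    f-functional = ∀I (∀I (∀I (⇒I (≐-trans 1 2 0 (≐-sym 2 1 (diagonal-≐ mf' 2 1 (∧E₁ h0))) (diagonal-≐ mf' 2 0 (∧E₂ h0))))))
      where
      mf' : diagonal-def 3 ∈ _ ∷ map weaken (map weaken (map weaken Γ))
      mf' = there (up (up (up mf)))

    f-injective : Γ ⊢ conjunct cardBody 6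
    f-injective = ∀I (∀I (∀I (⇒I (≐-trans 2 0 1 (diagonal-≐ mf' 2 0 (∧E₁ h0)) (≐-sym 1 0 (diagonal-≐ mf' 1 0 (∧E₂ h0)))))))
      where
      mf' : diagonal-def 3 ∈ _ ∷ map weaken (map weaken (map weaken Γ))
      mf' = there (up (up (up mf)))

    f-onto : Γ ⊢ conjunct cardBody 7
    f-onto = ∀I (⇒I (∃I (var 0) (⟨a,a⟩∈diagonal (there (up mf)) 0)))

  V-stratified : Stratified (var 0 ≐ var 0)
  V-stratified = (λ _ → 0) , (0 , tvar 0 , tvar 0)

  P-stratified : Stratified (S (var 0) ∧ᶠ ∀ᶠ (var 0 ∈ₛ var 1 ⇒ var 0 ∈ₛ var 2))
  P-stratified = (λ _ → 1) , ((1 , tvar 0) , (0 , ((0 , tvar 0 , tvar 1) , (0 , tvar 0 , tvar 2))))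

  diagonal-stratified : Stratified (∃ᶠ (var 1 ≐ ⟨ var 0 , var 0 ⟩))
  diagonal-stratified = (λ _ → 0) , (0 , (0 , tvar 1 , tpair (tvar 0) (tvar 0)))

  card-derivable : ∀ {Γ} → Γ ⊢ cardAx
  card-derivable =
    ∃E (ax (inj₁ (sc _ V-stratified))) (∃E (ax (inj₁ (sc _ P-stratified))) (∃E (ax (inj₁ (sc _ diagonal-stratified)))
      (∃I (var 2) (∃I (var 1) (∃I (var 0) (card-witness (here refl) (there (here refl)) (there (there (here refl)))))))))

  consistency-transferred : Consistent L NFAxiom → Consistent L NFU+card
  consistency-transferred = AxiomsDerivable.consistency-transferred derivable
    where
    derivable : ∀ {Γ φ} → NFU+card φ → Γ ⊢ φ
    derivable (inj₁ a)    = ax (inj₁ a)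
    derivable (inj₂ refl) = card-derivable

mainTheorem3 : Equiconsistent intuitionistic NFAxiom intuitionistic (NFUAxiom ⊕ cardAx)
             × Equiconsistent classical NFAxiom classical (NFUAxiom ⊕ cardAx)
mainTheorem3 = equiconsistent intuitionistic , equiconsistent classical
  where
  equiconsistent : ∀ L → Equiconsistent L NFAxiom L NFU+card
  equiconsistent L = EasyDirection.consistency-transferred {L} , HardDirection.consistency-reflected {L}
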